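{- Let $\mathcal A\subseteq\mathcal B$ be finite equidistributed (respectively, equidistributed dyadic) measured boolean algebras, with the measure on $\mathcal A$ the restriction of that on $\mathcal B$. Let $n\ge 1$ be an integer, $g$ an automorphism of $\mathcal A$ and $f$ an automorphism of $\mathcal B$ such that $f|_{\mathcal A}=g^n$. Then there is a finite equidistributed (respectively, equidistributed dyadic) measured boolean algebra $\mathcal C\supseteq\mathcal B$ (with measure extending that of $\mathcal B$) and an automorphism $h$ of $\mathcal C$ such that $h$ extends $g$ and $h^n|_{\mathcal B}=f$.
   Context: A finite boolean algebra with a probability measure is equidistributed if all its atoms have the same measure, and equidistributed dyadic if it has $2^k$ atoms each of measure $2^{ -k}$ for some $k\geq 0$. Automorphisms of such algebras (permutations of atoms) are automatically measure preserving. -}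

module Defs where

open import Data.Nat using (ℕ; zero; suc; _^_)
open import Data.Fin using (Fin; zero; suc; _≟_)
open import Data.Fin.Permutation using (Permutation′; _⟨$⟩ʳ_)
open import Data.Rational using (ℚ; 0ℚ; 1ℚ; _+_; _≤_)
open import Data.Product using (Σ; ∃; _×_)
open import Data.Bool using (if_then_else_)
open import Relation.Nullary.Decidable using (⌊_⌋)
open import Relation.Binary.PropositionalEquality using (_≡_)
open import Function using (_∘_)

sumℚ : ∀ {n} → (Fin n → ℚ) → ℚ
sumℚ {zero}  f = 0ℚ
sumℚ {suc n} f = f zero + sumℚ (f ∘ suc)

-- A finite measured (probability) boolean algebra, presented by its atoms:
-- it is the powerset algebra of Fin atoms, with the (probability) measure
-- determined by the measures of the atoms.
record FMBA : Set where
  field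
    atoms   : ℕ
    μ       : Fin atoms → ℚ
    μ-nonneg : ∀ i → 0ℚ ≤ μ i
    μ-total : sumℚ μ ≡ 1ℚ
open FMBA public

Equidistributed : FMBA → Set
Equidistributed A = ∀ i j → μ A i ≡ μ A j

-- 2^k atoms, each of measure 2^{-k} (the measure of each atom is then
-- forced to be 2^{-k} by equidistribution and total mass 1).
EquidistributedDyadic : FMBA → Set
EquidistributedDyadic A = Equidistributed A × ∃ λ k → atoms A ≡ 2 ^ k

data Kind : Set where
  equi dyadic : Kind

HasKind : Kind → FMBA → Set
HasKind equi   A = Equidistributed A
HasKind dyadic A = EquidistributedDyadic A

fiberMeasure : (B : FMBA) {a : ℕ} → (Fin (atoms B) → Fin a) → Fin a → ℚ
fiberMeasure B π i = sumℚ (λ x → if ⌊ π x ≟ i ⌋ then μ B x else 0ℚ)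

-- An embedding of measured boolean algebras A ⊆ B (measure of A the
-- restriction of that of B), given dually on atoms: each atom x of B lies
-- in the atom π x of A; every atom of A is the union of the B-atoms over it.
record Embedding (A B : FMBA) : Set where
  field
    π          : Fin (atoms B) → Fin (atoms A)
    surjective : ∀ i → ∃ λ x → π x ≡ i
    restrict   : ∀ i → μ A i ≡ fiberMeasure B π i
open Embedding public

-- Automorphisms of a finite boolean algebra = permutations of its atoms.
Aut : FMBA → Set
Aut A = Permutation′ (atoms A)

pow : ∀ {A : FMBA} → Aut A → ℕ → Fin (atoms A) → Fin (atoms A)
pow g zero    x = x
pow {A} g (suc n) x = g ⟨$⟩ʳ pow {A} g n x

module Submission where

-- Equidistribution forces every atom of A to contain the same number m of atoms of B,
-- so B ≅ A × Fin m over A (a trivialisation, obtained by numbering each fibre).  Since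
-- f covers gⁿ it acts on fibres: f (a , j) = (gⁿ a , φ a j) with every φ a bijective.
-- The atoms of C are the states (a , j₀ ∷ ⋯ ∷ j_k) of a shift register, n = k + 1,
-- lying in the atom (a , j₀) of B, and h (a , j₀ ∷ js) = (g a , js ∷ʳ φ a j₀).  Then h
-- covers g, is invertible as g and all φ a are, and after n steps the first digit is
-- φ a j₀, i.e. hⁿ covers f.  Splitting each atom of B into m ^ k atoms of equal mass
-- makes C equidistributed, and dyadic when A and B are (m is then a power of two).


open import Defs
open import Data.Nat as ℕ using (ℕ; zero; suc; _≥_; _^_; z≤n; s≤s)
import Data.Nat.Properties as ℕP
open import Data.Nat.GeneralisedArithmetic using (fold; iterate; iterate-is-fold)
open import Data.Fin as Fin using (Fin; zero; suc; _≟_; combine; remQuot; _↑ˡ_; _↑ʳ_)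
import Data.Fin.Properties as FinP
open import Data.Fin.Permutation using (Permutation′; _⟨$⟩ʳ_; _⟨$⟩ˡ_; inverseˡ; inverseʳ)
open import Data.Vec as Vec using (Vec; []; _∷_; _∷ʳ_; head; init; last)
import Data.Vec.Properties as VecP
open import Data.Vec.Recursive using (Fin[m^n]↔Fin[m]^n)
open import Data.Vec.Recursive.Properties using (↔Vec)
open import Data.List using (List; []; _∷_; _++_; [_]; length)
import Data.List.Properties as ListP
open import Data.Rational as ℚ using (ℚ; 0ℚ; 1ℚ; _+_; _*_; _≤_; _<_; 1/_)
import Data.Rational.Properties as ℚP
open import Algebra.Bundles using (CommutativeRing)
open import Algebra.Properties.Semiring.Mult (CommutativeRing.semiring ℚP.+-*-commutativeRing)
  using (×-assocˡ; ×-assoc-*) renaming (_×_ to _·_)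
open import Algebra.Properties.Group ℚP.+-0-group using (∙-cancelˡ)
open import Data.Bool using (Bool; true; false; if_then_else_; T)
open import Data.Product using (Σ; ∃; _×_; _,_; proj₁; proj₂)
open import Data.Empty using (⊥-elim)
open import Relation.Nullary using (yes; no; ¬_; contradiction)
open import Relation.Nullary.Decidable using (⌊_⌋; _×-dec_; toWitness; fromWitness)
open import Relation.Binary.PropositionalEquality hiding ([_])
open import Function using (_∘_; _↔_; Inverse; mk↔ₛ′; Injective)
open import Function.Properties.Inverse using (↔-trans; ↔-sym)
open import Relation.Binary.Definitions using (tri<; tri≈; tri>)

·-zeroʳ : ∀ n → n · 0ℚ ≡ 0ℚ
·-zeroʳ zero    = refl
·-zeroʳ (suc n) = trans (ℚP.+-identityˡ _) (·-zeroʳ n)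

·-nonneg : ∀ n {c} → 0ℚ ≤ c → 0ℚ ≤ n · c
·-nonneg zero    c≥0 = ℚP.≤-refl
·-nonneg (suc n) c≥0 = ℚP.+-mono-≤ c≥0 (·-nonneg n c≥0)

·-positive : ∀ n {c} → 0ℚ < c → 0ℚ < suc n · c
·-positive n c>0 = ℚP.+-mono-<-≤ c>0 (·-nonneg n (ℚP.<⇒≤ c>0))

·-cancelʳ : ∀ {c} → 0ℚ < c → ∀ m n → m · c ≡ n · c → m ≡ n
·-cancelʳ c>0 zero    zero    eq = refl
·-cancelʳ c>0 zero    (suc n) eq = ⊥-elim (ℚP.<-irrefl eq (·-positive n c>0))
·-cancelʳ c>0 (suc m) zero    eq = ⊥-elim (ℚP.<-irrefl (sym eq) (·-positive m c>0))
·-cancelʳ {c} c>0 (suc m) (suc n) eq = cong suc (·-cancelʳ c>0 m n (∙-cancelˡ c _ _ eq))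

divide : ∀ M → 0 ℕ.< M → ∀ c → 0ℚ ≤ c → Σ ℚ λ d → 0ℚ ≤ d × M · d ≡ c
divide (suc M) _ c c≥0 = d , d≥0 , M·d≡c
  where
  p : ℚ
  p = suc M · 1ℚ
  instance
    p-positive : ℚ.Positive p
    p-positive = ℚ.positive (·-positive M (ℚP.positive⁻¹ 1ℚ))
    p-nonZero : ℚ.NonZero p
    p-nonZero = ℚP.pos⇒nonZero p
  d : ℚ
  d = (1/ p) * c
  d≥0 : 0ℚ ≤ d
  d≥0 = ℚP.nonNegative⁻¹ d {{ℚP.nonNeg*nonNeg⇒nonNeg (1/ p) {{1/p≥0}} c {{ℚ.nonNegative c≥0}}}}
    where
    1/p≥0 : ℚ.NonNegative (1/ p)
    1/p≥0 = ℚP.pos⇒nonNeg (1/ p) {{ℚP.1/pos⇒pos p}}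
  M·d≡c : suc M · d ≡ c
  M·d≡c = begin
    suc M · d            ≡⟨ cong (suc M ·_) (sym (ℚP.*-identityˡ d)) ⟩
    suc M · (1ℚ * d)     ≡⟨ sym (×-assoc-* (suc M) 1ℚ d) ⟩
    p * ((1/ p) * c)     ≡⟨ sym (ℚP.*-assoc p (1/ p) c) ⟩
    (p * 1/ p) * c       ≡⟨ cong (_* c) (ℚP.*-inverseʳ p) ⟩
    1ℚ * c               ≡⟨ ℚP.*-identityˡ c ⟩
    c                    ∎
    where open ≡-Reasoning

sumℚ-cong : ∀ {n} {f g : Fin n → ℚ} → (∀ x → f x ≡ g x) → sumℚ f ≡ sumℚ g
sumℚ-cong {zero}  eq = refl
sumℚ-cong {suc n} eq = cong₂ _+_ (eq zero) (sumℚ-cong (eq ∘ suc))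

sumℚ-const : ∀ n c → sumℚ {n} (λ _ → c) ≡ n · c
sumℚ-const zero    c = refl
sumℚ-const (suc n) c = cong (c +_) (sumℚ-const n c)

sumℚ-+ : ∀ a {b} (f : Fin (a ℕ.+ b) → ℚ) →
  sumℚ f ≡ sumℚ (f ∘ (_↑ˡ b)) + sumℚ (f ∘ (a ↑ʳ_))
sumℚ-+ zero    f = sym (ℚP.+-identityˡ _)
sumℚ-+ (suc a) f =
  trans (cong (f zero +_) (sumℚ-+ a (f ∘ suc))) (sym (ℚP.+-assoc (f zero) _ _))

sumℚ-* : ∀ a b (f : Fin (a ℕ.* b) → ℚ) →
  sumℚ f ≡ sumℚ {a} (λ i → sumℚ {b} (λ j → f (combine i j)))
sumℚ-* zero    b f = refl
sumℚ-* (suc a) b f =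
  trans (sumℚ-+ b f) (cong (sumℚ (f ∘ (_↑ˡ a ℕ.* b)) +_) (sumℚ-* a b (f ∘ (b ↑ʳ_))))

sumℚ-delta : ∀ {n} (b : Fin n) c → sumℚ (λ i → if ⌊ i ≟ b ⌋ then c else 0ℚ) ≡ c
sumℚ-delta {suc n} zero c = begin
  c + sumℚ {n} (λ _ → 0ℚ) ≡⟨ cong (c +_) (trans (sumℚ-const n 0ℚ) (·-zeroʳ n)) ⟩
  c + 0ℚ                  ≡⟨ ℚP.+-identityʳ c ⟩
  c                       ∎
  where open ≡-Reasoning
sumℚ-delta {suc n} (suc b) c =
  trans (ℚP.+-identityˡ _) (trans (sumℚ-cong shift) (sumℚ-delta b c))
  where
  shift : ∀ x → (if ⌊ suc x ≟ suc b ⌋ then c else 0ℚ) ≡ (if ⌊ x ≟ b ⌋ then c else 0ℚ)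
  shift x with x ≟ b
  ... | yes _ = refl
  ... | no _  = refl

bit : Bool → ℕ
bit b = if b then 1 else 0

count : ∀ {n} → (Fin n → Bool) → ℕ
count {zero}  p = 0
count {suc n} p = bit (p zero) ℕ.+ count (p ∘ suc)

sumℚ-indicator : ∀ {n} (p : Fin n → Bool) c → sumℚ (λ x → if p x then c else 0ℚ) ≡ count p · c
sumℚ-indicator {zero}  p c = refl
sumℚ-indicator {suc n} p c with p zero
... | true  = cong (c +_) (sumℚ-indicator (p ∘ suc) c)
... | false = trans (ℚP.+-identityˡ _) (sumℚ-indicator (p ∘ suc) c)

bit-mono : ∀ {a b} → (T a → T b) → bit a ℕ.≤ bit b
bit-mono {false}         _   = z≤n
bit-mono {true}  {true}  _   = ℕP.≤-refl
bit-mono {true}  {false} a⇒b = ⊥-elim (a⇒b _)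

bit-< : ∀ {a b} → T b → ¬ T a → bit a ℕ.< bit b
bit-< {false} {true} _ _  = s≤s z≤n
bit-< {true}         _ ¬a = ⊥-elim (¬a _)

count-mono : ∀ {n} {p q : Fin n → Bool} → (∀ x → T (p x) → T (q x)) → count p ℕ.≤ count q
count-mono {zero}  p⇒q = z≤n
count-mono {suc n} p⇒q = ℕP.+-mono-≤ (bit-mono (p⇒q zero)) (count-mono (p⇒q ∘ suc))

count-mono-< : ∀ {n} {p q : Fin n → Bool} → (∀ x → T (p x) → T (q x)) →
  ∀ x → T (q x) → ¬ T (p x) → count p ℕ.< count q
count-mono-< p⇒q zero    qx ¬px = ℕP.+-mono-<-≤ (bit-< qx ¬px) (count-mono (p⇒q ∘ suc))
count-mono-< p⇒q (suc x) qx ¬px = ℕP.+-mono-≤-< (bit-mono (p⇒q zero)) (count-mono-< (p⇒q ∘ suc) x qx ¬px)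

some-atom : (X : FMBA) → Fin (atoms X)
some-atom X = inhabited (μ X) (μ-total X)
  where
  inhabited : ∀ {n} (w : Fin n → ℚ) → sumℚ w ≡ 1ℚ → Fin n
  inhabited {zero}  w ()
  inhabited {suc n} w _ = zero

equi-total : (X : FMBA) → Equidistributed X → ∀ i → atoms X · μ X i ≡ 1ℚ
equi-total X eqX i = trans (sym (sumℚ-const (atoms X) (μ X i)))
                           (trans (sumℚ-cong (eqX i)) (μ-total X))

equi-positive : (X : FMBA) → Equidistributed X → ∀ i → 0ℚ < μ X i
equi-positive X eqX i =
  ℚP.positive⁻¹ c {{ℚP.nonNeg∧nonZero⇒pos c {{ℚ.nonNegative (μ-nonneg X i)}} {{ℚ.≢-nonZero c≢0}}}}
  where
  c = μ X i
  c≢0 : c ≢ 0ℚ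
  c≢0 c≡0 with trans (sym (equi-total X eqX i)) (trans (cong (atoms X ·_) c≡0) (·-zeroʳ (atoms X)))
  ... | ()

fibreSize : ∀ {N a} → (Fin N → Fin a) → Fin a → ℕ
fibreSize π i = count (λ x → ⌊ π x ≟ i ⌋)

fiberMeasure-equi : (B : FMBA) → Equidistributed B → ∀ {a} (π : Fin (atoms B) → Fin a) i b →
  fiberMeasure B π i ≡ fibreSize π i · μ B b
fiberMeasure-equi B eqB π i b =
  trans (sumℚ-cong (λ x → cong (if ⌊ π x ≟ i ⌋ then_else 0ℚ) (eqB x b)))
        (sumℚ-indicator (λ x → ⌊ π x ≟ i ⌋) (μ B b))

-- For equidistributed A ⊆ B all atoms of A contain the same number m of atoms of B,
-- and then atoms A * m = atoms B.  (Opaque: its proof goes through rational arithmetic,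
-- which the type checker must never unfold when computing with the resulting m.)
opaque
  uniform-fibres : (A B : FMBA) → Equidistributed A → Equidistributed B → (e : Embedding A B) →
    Σ ℕ λ m → (∀ a → fibreSize (π e) a ≡ m) × atoms A ℕ.* m ≡ atoms B
  uniform-fibres A B eqA eqB e = m , fibres , size
    where
    a₀ : Fin (atoms A)
    a₀ = some-atom A
    b₀ : Fin (atoms B)
    b₀ = some-atom B
    c : ℚ
    c = μ B b₀
    c>0 : 0ℚ < c
    c>0 = equi-positive B eqB b₀
    m : ℕ
    m = fibreSize (π e) a₀

    μA : ∀ a → μ A a ≡ fibreSize (π e) a · c
    μA a = trans (restrict e a) (fiberMeasure-equi B eqB (π e) a b₀)

    fibres : ∀ a → fibreSize (π e) a ≡ m
    fibres a = ·-cancelʳ c>0 _ _ (trans (sym (μA a)) (trans (eqA a a₀) (μA a₀)))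

    size : atoms A ℕ.* m ≡ atoms B
    size = ·-cancelʳ c>0 _ _ (begin
      (atoms A ℕ.* m) · c ≡⟨ sym (×-assocˡ c (atoms A) m) ⟩
      atoms A · (m · c)   ≡⟨ cong (atoms A ·_) (sym (μA a₀)) ⟩
      atoms A · μ A a₀    ≡⟨ equi-total A eqA a₀ ⟩
      1ℚ                  ≡⟨ sym (equi-total B eqB b₀) ⟩
      atoms B · c         ∎)
      where open ≡-Reasoning

injective⇒surjective : ∀ {m n} → m ≡ n → (f : Fin m → Fin n) → Injective _≡_ _≡_ f →
  ∀ y → ∃ λ x → f x ≡ y
injective⇒surjective {suc n} refl f f-inj y with FinP.any? (λ x → f x ≟ y)
... | yes found = found
... | no ¬found = contradiction (FinP.injective⇒≤ avoid-y-injective) ℕP.1+n≰n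
  where
  f≢y : ∀ x → y ≢ f x
  f≢y x y≡fx = ¬found (x , sym y≡fx)
  avoid-y : Fin (suc n) → Fin n
  avoid-y x = Fin.punchOut (f≢y x)
  avoid-y-injective : Injective _≡_ _≡_ avoid-y
  avoid-y-injective eq = f-inj (FinP.punchOut-injective (f≢y _) (f≢y _) eq)

injection⇒↔ : ∀ {m n} → m ≡ n → (f : Fin m → Fin n) → Injective _≡_ _≡_ f → Fin m ↔ Fin n
injection⇒↔ m≡n f f-inj =
  mk↔ₛ′ f (proj₁ ∘ preimage) (proj₂ ∘ preimage) (λ x → f-inj (proj₂ (preimage (f x))))
  where
  preimage : ∀ y → ∃ λ x → f x ≡ y
  preimage = injective⇒surjective m≡n f f-inj

record Trivialisation {N a : ℕ} (π : Fin N → Fin a) (m : ℕ) : Set where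
  field
    coords : Fin N ↔ (Fin a × Fin m)
    over   : ∀ b → proj₁ (Inverse.to coords b) ≡ π b

  open Inverse coords using (to; from; strictlyInverseˡ; strictlyInverseʳ)

  point : Fin a → Fin m → Fin N
  point i j = from (i , j)

  coord : Fin N → Fin m
  coord b = proj₂ (to b)

  π-point : ∀ i j → π (point i j) ≡ i
  π-point i j = trans (sym (over (point i j))) (cong proj₁ (strictlyInverseˡ (i , j)))

  coord-point : ∀ i j → coord (point i j) ≡ j
  coord-point i j = cong proj₂ (strictlyInverseˡ (i , j))

  point-coord : ∀ {i} b → π b ≡ i → point i (coord b) ≡ b
  point-coord b refl = trans (cong (λ i → from (i , coord b)) (sym (over b))) (strictlyInverseʳ b)

-- If all fibres of π : Fin N → Fin a have m elements and a * m = N, then π is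
-- trivialised by numbering each fibre in increasing order.
module Ranking {N a m : ℕ} (π : Fin N → Fin a)
  (fibres : ∀ i → fibreSize π i ≡ m) (size : a ℕ.* m ≡ N) where

  earlier : Fin N → Fin N → Bool
  earlier b x = ⌊ (x FinP.<? b) ×-dec (π x ≟ π b) ⌋

  rank : Fin N → ℕ
  rank b = count (earlier b)

  not-earlier-than-itself : ∀ b → ¬ T (earlier b b)
  not-earlier-than-itself b = FinP.<-irrefl refl ∘ proj₁ ∘ toWitness

  rank<m : ∀ b → rank b ℕ.< m
  rank<m b = subst (rank b ℕ.<_) (fibres (π b))
    (count-mono-< (λ x → fromWitness ∘ proj₂ ∘ toWitness) b (fromWitness refl) (not-earlier-than-itself b))

  rank-< : ∀ {b b'} → π b ≡ π b' → b Fin.< b' → rank b ℕ.< rank b'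
  rank-< {b} {b'} πb≡πb' b<b' =
    count-mono-< earlier-mono b (fromWitness (b<b' , πb≡πb')) (not-earlier-than-itself b)
    where
    earlier-mono : ∀ x → T (earlier b x) → T (earlier b' x)
    earlier-mono x x-earlier with toWitness x-earlier
    ... | x<b , πx≡πb = fromWitness (FinP.<-trans x<b b<b' , trans πx≡πb πb≡πb')

  rank-injective : ∀ {b b'} → π b ≡ π b' → rank b ≡ rank b' → b ≡ b'
  rank-injective {b} {b'} πb≡πb' rb≡rb' with FinP.<-cmp b b'
  ... | tri< b<b' _ _ = contradiction rb≡rb' (ℕP.<⇒≢ (rank-< πb≡πb' b<b'))
  ... | tri≈ _ b≡b' _ = b≡b'
  ... | tri> _ _ b>b' = contradiction (sym rb≡rb') (ℕP.<⇒≢ (rank-< (sym πb≡πb') b>b'))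

  position : Fin N → Fin m
  position b = Fin.fromℕ< (rank<m b)

  label : Fin N → Fin (a ℕ.* m)
  label b = combine (π b) (position b)

  label-injective : Injective _≡_ _≡_ label
  label-injective {b} {b'} eq with FinP.combine-injective (π b) (position b) (π b') (position b') eq
  ... | πb≡πb' , pos≡pos' = rank-injective πb≡πb'
    (trans (sym (FinP.toℕ-fromℕ< _)) (trans (cong Fin.toℕ pos≡pos') (FinP.toℕ-fromℕ< _)))

  trivialisation : Trivialisation π m
  trivialisation = record
    { coords = ↔-trans (injection⇒↔ (sym size) label label-injective) FinP.*↔×
    ; over   = λ b → cong proj₁ (FinP.remQuot-combine (π b) (position b))
    }

iterate-natural : ∀ {A B : Set} {F : A → A} {G : B → B} (t : A → B) →
  (∀ a → t (F a) ≡ G (t a)) → ∀ a n → t (iterate F a n) ≡ iterate G (t a) n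
iterate-natural t comm a zero = refl
iterate-natural {F = F} {G} t comm a (suc n) =
  trans (iterate-natural t comm (F a) n) (cong (λ b → iterate G b n) (comm a))

pow≡iterate : ∀ {X : FMBA} (g : Aut X) n x → pow {X} g n x ≡ iterate (g ⟨$⟩ʳ_) x n
pow≡iterate {X} g n x = trans (pow≡fold n) (iterate-is-fold x (g ⟨$⟩ʳ_) n)
  where
  pow≡fold : ∀ n → pow {X} g n x ≡ fold x (g ⟨$⟩ʳ_) n
  pow≡fold zero    = refl
  pow≡fold (suc n) = cong (g ⟨$⟩ʳ_) (pow≡fold n)

pow-injective : ∀ {X : FMBA} (g : Aut X) n → Injective _≡_ _≡_ (pow {X} g n)
pow-injective g zero    eq = eq
pow-injective g (suc n) eq =
  pow-injective g n (trans (sym (inverseˡ g)) (trans (cong (g ⟨$⟩ˡ_) eq) (inverseˡ g)))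

toList-∷ʳ : ∀ {M : Set} {k} (js : Vec M k) r → Vec.toList (js ∷ʳ r) ≡ Vec.toList js ++ [ r ]
toList-∷ʳ []       r = refl
toList-∷ʳ (j ∷ js) r = cong (j ∷_) (toList-∷ʳ js r)

module ShiftRegister {X M : Set} (σ : X → X) (φ : X → M → M) where

  step : ∀ {k} → X × Vec M (suc k) → X × Vec M (suc k)
  step (x , j ∷ js) = σ x , js ∷ʳ φ x j

  proj₁-step : ∀ {k} (s : X × Vec M (suc k)) → proj₁ (step s) ≡ σ (proj₁ s)
  proj₁-step (x , j ∷ js) = refl

  stepL : X × List M → X × List M
  stepL (x , [])     = σ x , []
  stepL (x , j ∷ js) = σ x , js ++ [ φ x j ]

  outputs : X → List M → List M
  outputs x []       = []
  outputs x (j ∷ js) = φ x j ∷ outputs (σ x) js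

  stepL-iterate : ∀ x u w →
    iterate stepL (x , u ++ w) (length u) ≡ (iterate σ x (length u) , w ++ outputs x u)
  stepL-iterate x []      w = cong (x ,_) (sym (ListP.++-identityʳ w))
  stepL-iterate x (j ∷ u) w = begin
    iterate stepL (σ x , (u ++ w) ++ [ φ x j ]) (length u)
      ≡⟨ cong (λ l → iterate stepL (σ x , l) (length u)) (ListP.++-assoc u w _) ⟩
    iterate stepL (σ x , u ++ (w ++ [ φ x j ])) (length u)
      ≡⟨ stepL-iterate (σ x) u _ ⟩
    (iterate σ (σ x) (length u) , (w ++ [ φ x j ]) ++ outputs (σ x) u)
      ≡⟨ cong (_ ,_) (ListP.++-assoc w _ _) ⟩
    (iterate σ (σ x) (length u) , w ++ outputs x (j ∷ u)) ∎
    where open ≡-Reasoning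

  forget-length : ∀ {k} → X × Vec M k → X × List M
  forget-length (x , v) = x , Vec.toList v

  forget-length-step : ∀ {k} (s : X × Vec M (suc k)) → forget-length (step s) ≡ stepL (forget-length s)
  forget-length-step (x , j ∷ js) = cong (σ x ,_) (toList-∷ʳ js (φ x j))

  iterate-on-lists : ∀ {k} x j (js : Vec M k) →
    forget-length (iterate step (x , j ∷ js) (suc k))
      ≡ (iterate σ x (suc k) , outputs x (j ∷ Vec.toList js))
  iterate-on-lists {k} x j js = begin
    forget-length (iterate step (x , j ∷ js) (suc k))
      ≡⟨ iterate-natural forget-length forget-length-step (x , j ∷ js) (suc k) ⟩
    iterate stepL (x , u) (suc k)
      ≡⟨ cong₂ (λ l n → iterate stepL (x , l) n) (sym (ListP.++-identityʳ u)) (sym |u|≡1+k) ⟩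
    iterate stepL (x , u ++ []) (length u)
      ≡⟨ stepL-iterate x u [] ⟩
    (iterate σ x (length u) , outputs x u)
      ≡⟨ cong (λ n → iterate σ x n , outputs x u) |u|≡1+k ⟩
    (iterate σ x (suc k) , outputs x u) ∎
    where
    open ≡-Reasoning
    u : List M
    u = j ∷ Vec.toList js
    |u|≡1+k : length u ≡ suc k
    |u|≡1+k = cong suc (VecP.length-toList js)

  step-iterate : ∀ {k} x j (js : Vec M k) → let s = iterate step (x , j ∷ js) (suc k) in
    proj₁ s ≡ iterate σ x (suc k) × head (proj₂ s) ≡ φ x j
  step-iterate {k} x j js with iterate step (x , j ∷ js) (suc k) | iterate-on-lists x j js
  ... | x' , (j' ∷ js') | eq = cong proj₁ eq , ListP.∷-injectiveˡ (cong proj₂ eq)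

  module Invertible (σ⁻¹ : X → X) (σσ⁻¹ : ∀ y → σ (σ⁻¹ y) ≡ y) (σ⁻¹σ : ∀ x → σ⁻¹ (σ x) ≡ x)
    (ψ : X → M → M) (φψ : ∀ x r → φ x (ψ x r) ≡ r) (ψφ : ∀ x j → ψ x (φ x j) ≡ j) where

    unstep : ∀ {k} → X × Vec M (suc k) → X × Vec M (suc k)
    unstep (y , v) = σ⁻¹ y , ψ (σ⁻¹ y) (last v) ∷ init v

    step-unstep : ∀ {k} (s : X × Vec M (suc k)) → step (unstep s) ≡ s
    step-unstep (y , v) = cong₂ _,_ (σσ⁻¹ y)
      (trans (cong (init v ∷ʳ_) (φψ (σ⁻¹ y) (last v))) (sym (proj₂ (proj₂ (Vec.initLast v)))))

    unstep-step : ∀ {k} (s : X × Vec M (suc k)) → unstep (step s) ≡ s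
    unstep-step (x , j ∷ js) = cong₂ _,_ (σ⁻¹σ x) (cong₂ _∷_
      (trans (cong₂ ψ (σ⁻¹σ x) (VecP.last-∷ʳ (φ x j) js)) (ψφ x j))
      (VecP.init-∷ʳ (φ x j) js))

    register : ∀ {k} → (X × Vec M (suc k)) ↔ (X × Vec M (suc k))
    register = mk↔ₛ′ step unstep step-unstep unstep-step

module Refinement (B : FMBA) (eqB : Equidistributed B) (M : ℕ) (M>0 : 0 ℕ.< M) where

  N : ℕ
  N = atoms B

  b₀ : Fin N
  b₀ = some-atom B

  share : Σ ℚ λ c → 0ℚ ≤ c × M · c ≡ μ B b₀
  share = divide M M>0 (μ B b₀) (μ-nonneg B b₀)

  c : ℚ
  c = proj₁ share

  total : sumℚ {N ℕ.* M} (λ _ → c) ≡ 1ℚ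
  total = begin
    sumℚ {N ℕ.* M} (λ _ → c) ≡⟨ sumℚ-const (N ℕ.* M) c ⟩
    (N ℕ.* M) · c            ≡⟨ sym (×-assocˡ c N M) ⟩
    N · (M · c)              ≡⟨ cong (N ·_) (proj₂ (proj₂ share)) ⟩
    N · μ B b₀               ≡⟨ equi-total B eqB b₀ ⟩
    1ℚ                       ∎
    where open ≡-Reasoning

  refinement : FMBA
  refinement = record
    { atoms    = N ℕ.* M
    ; μ        = λ _ → c
    ; μ-nonneg = λ _ → proj₁ (proj₂ share)
    ; μ-total  = total
    }

  refinement-equi : Equidistributed refinement
  refinement-equi _ _ = refl

  coarse : Fin (N ℕ.* M) → Fin N
  coarse z = proj₁ (remQuot M z)

  restriction : ∀ b → μ B b ≡ fiberMeasure refinement coarse b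
  restriction b = sym (begin
    sumℚ (λ z → if ⌊ coarse z ≟ b ⌋ then c else 0ℚ)
      ≡⟨ sumℚ-* N M _ ⟩
    sumℚ {N} (λ i → sumℚ {M} (λ j → if ⌊ coarse (combine i j) ≟ b ⌋ then c else 0ℚ))
      ≡⟨ sumℚ-cong (λ i → trans (sumℚ-cong (λ j → cong (λ k → if ⌊ k ≟ b ⌋ then c else 0ℚ)
                                              (cong proj₁ (FinP.remQuot-combine {N} {M} i j))))
                               (sumℚ-const M _)) ⟩
    sumℚ (λ i → M · (if ⌊ i ≟ b ⌋ then c else 0ℚ))
      ≡⟨ sumℚ-cong (λ i → M·indicator ⌊ i ≟ b ⌋) ⟩
    sumℚ (λ i → if ⌊ i ≟ b ⌋ then μ B b₀ else 0ℚ)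
      ≡⟨ sumℚ-delta b (μ B b₀) ⟩
    μ B b₀
      ≡⟨ eqB b₀ b ⟩
    μ B b ∎)
    where
    open ≡-Reasoning
    M·indicator : ∀ t → M · (if t then c else 0ℚ) ≡ (if t then μ B b₀ else 0ℚ)
    M·indicator true  = proj₂ (proj₂ share)
    M·indicator false = ·-zeroʳ M

  embedding : Embedding B refinement
  embedding = record
    { π          = coarse
    ; surjective = λ b → combine b (Fin.fromℕ< M>0) , cong proj₁ (FinP.remQuot-combine {N} {M} b _)
    ; restrict   = restriction
    }

power-of-two-factor : ∀ r s m → 2 ^ r ℕ.* m ≡ 2 ^ s → ∃ λ t → m ≡ 2 ^ t
power-of-two-factor zero    s       m eq = s , trans (sym (ℕP.*-identityˡ m)) eq
power-of-two-factor (suc r) zero    m eq =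
  contradiction (ℕP.m*n≡1⇒m≡1 2 (2 ^ r ℕ.* m) (trans (sym (ℕP.*-assoc 2 (2 ^ r) m)) eq)) λ ()
power-of-two-factor (suc r) (suc s) m eq =
  power-of-two-factor r s m (ℕP.*-cancelˡ-≡ _ _ 2 (trans (sym (ℕP.*-assoc 2 (2 ^ r) m)) eq))

equidistributed : ∀ κ X → HasKind κ X → Equidistributed X
equidistributed equi   X eqX       = eqX
equidistributed dyadic X (eqX , _) = eqX

module FibreAction {N a m : ℕ} {π : Fin N → Fin a} (T : Trivialisation π m) (f : Permutation′ N)
  (τ : Fin a → Fin a) (τ-injective : Injective _≡_ _≡_ τ)
  (covers : ∀ b → π (f ⟨$⟩ʳ b) ≡ τ (π b)) where

  open Trivialisation T

  φ : Fin a → Fin m → Fin m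
  φ i j = coord (f ⟨$⟩ʳ point i j)

  ψ : Fin a → Fin m → Fin m
  ψ i r = coord (f ⟨$⟩ˡ point (τ i) r)

  f-point : ∀ i j → f ⟨$⟩ʳ point i j ≡ point (τ i) (φ i j)
  f-point i j = sym (point-coord _ (trans (covers (point i j)) (cong τ (π-point i j))))

  ψφ : ∀ i j → ψ i (φ i j) ≡ j
  ψφ i j = begin
    coord (f ⟨$⟩ˡ point (τ i) (φ i j)) ≡⟨ cong (coord ∘ (f ⟨$⟩ˡ_)) (sym (f-point i j)) ⟩
    coord (f ⟨$⟩ˡ (f ⟨$⟩ʳ point i j))  ≡⟨ cong coord (inverseˡ f) ⟩
    coord (point i j)                  ≡⟨ coord-point i j ⟩
    j                                  ∎
    where open ≡-Reasoning

  φψ : ∀ i r → φ i (ψ i r) ≡ r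
  φψ i r = begin
    coord (f ⟨$⟩ʳ point i (coord (f ⟨$⟩ˡ y))) ≡⟨ cong (coord ∘ (f ⟨$⟩ʳ_)) (point-coord _ over-i) ⟩
    coord (f ⟨$⟩ʳ (f ⟨$⟩ˡ y))                ≡⟨ cong coord (inverseʳ f) ⟩
    coord y                                  ≡⟨ coord-point (τ i) r ⟩
    r                                        ∎
    where
    open ≡-Reasoning
    y : Fin N
    y = point (τ i) r
    over-i : π (f ⟨$⟩ˡ y) ≡ i
    over-i = τ-injective
      (trans (sym (covers (f ⟨$⟩ˡ y))) (trans (cong π (inverseʳ f)) (π-point (τ i) r)))

-- The construction behind Proposition 2.2, for n = k + 1.  Writing B ≅ A × Fin m by a
-- trivialisation, the atoms of C are register states (a , j₀ ∷ ⋯ ∷ j_k) ∈ A × Fin m ^ (k+1),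
-- encoded as Fin (atoms B * m ^ k); the atom of B containing (a , j₀ ∷ js) is (a , j₀).
module Extension (A B : FMBA) (eqA : Equidistributed A) (eqB : Equidistributed B)
  (e : Embedding A B) (k : ℕ) (g : Aut A) (f : Aut B)
  (f-covers : ∀ x → π e (f ⟨$⟩ʳ x) ≡ pow {A} g (suc k) (π e x)) where

  fibres : Σ ℕ λ m → (∀ a → fibreSize (π e) a ≡ m) × atoms A ℕ.* m ≡ atoms B
  fibres = uniform-fibres A B eqA eqB e

  m : ℕ
  m = proj₁ fibres

  trivialisation : Trivialisation (π e) m
  trivialisation = Ranking.trivialisation (π e) (proj₁ (proj₂ fibres)) (proj₂ (proj₂ fibres))

  open Trivialisation trivialisation
  open FibreAction trivialisation f (pow {A} g (suc k)) (pow-injective g (suc k)) f-covers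
  open ShiftRegister (g ⟨$⟩ʳ_) φ
  open Invertible (g ⟨$⟩ˡ_) (λ _ → inverseʳ g) (λ _ → inverseˡ g) ψ φψ ψφ

  State : Set
  State = Fin (atoms A) × Vec (Fin m) (suc k)

  cell : State → Fin (atoms B)
  cell (a , v) = point a (head v)

  register-covers-f : ∀ s → cell (iterate step s (suc k)) ≡ f ⟨$⟩ʳ cell s
  register-covers-f (a , j ∷ js) = begin
    point (proj₁ s') (head (proj₂ s'))
      ≡⟨ cong₂ point (trans (proj₁ (step-iterate a j js)) (sym (pow≡iterate g (suc k) a)))
                     (proj₂ (step-iterate a j js)) ⟩
    point (pow {A} g (suc k) a) (φ a j) ≡⟨ sym (f-point a j) ⟩
    f ⟨$⟩ʳ point a j                     ∎
    where
    open ≡-Reasoning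
    s' : State
    s' = iterate step (a , j ∷ js) (suc k)

  -- C refines B by splitting each atom into m ^ k atoms (m > 0 as B has an atom).
  instance
    m-nonZero : ℕ.NonZero m
    m-nonZero = FinP.nonZeroIndex (coord (some-atom B))

  open Refinement B eqB (m ^ k) (ℕP.m^n>0 m k) public
    using (refinement; refinement-equi; coarse; embedding)

  digits : Fin (m ^ k) ↔ Vec (Fin m) k
  digits = ↔-trans (Fin[m^n]↔Fin[m]^n m k) (↔Vec k)

  encoding : Fin (atoms B ℕ.* m ^ k) ↔ State
  encoding = ↔-trans FinP.*↔× (mk↔ₛ′ to-state from-state to-from from-to)
    where
    open Inverse digits using (to; from; strictlyInverseˡ; strictlyInverseʳ)
    to-state : Fin (atoms B) × Fin (m ^ k) → State
    to-state (b , i) = π e b , coord b ∷ to i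
    from-state : State → Fin (atoms B) × Fin (m ^ k)
    from-state (a , j ∷ js) = point a j , from js
    to-from : ∀ s → to-state (from-state s) ≡ s
    to-from (a , j ∷ js) =
      cong₂ _,_ (π-point a j) (cong₂ _∷_ (coord-point a j) (strictlyInverseˡ js))
    from-to : ∀ p → from-state (to-state p) ≡ p
    from-to (b , i) = cong₂ _,_ (point-coord b refl) (strictlyInverseʳ i)

  open Inverse encoding using (to; from; strictlyInverseˡ)

  coarse≡cell : ∀ z → coarse z ≡ cell (to z)
  coarse≡cell z = sym (point-coord (coarse z) refl)

  coarse-from : ∀ s → coarse (from s) ≡ cell s
  coarse-from s = trans (coarse≡cell (from s)) (cong cell (strictlyInverseˡ s))

  h : Aut refinement
  h = ↔-trans encoding (↔-trans register (↔-sym encoding))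

  h-covers-g : ∀ z → π e (coarse (h ⟨$⟩ʳ z)) ≡ g ⟨$⟩ʳ π e (coarse z)
  h-covers-g z = begin
    π e (coarse (h ⟨$⟩ʳ z))        ≡⟨ cong (π e) (coarse-from (step s)) ⟩
    π e (cell (step s))           ≡⟨ π-point _ _ ⟩
    proj₁ (step s)                ≡⟨ proj₁-step s ⟩
    g ⟨$⟩ʳ proj₁ s                 ≡⟨ cong (g ⟨$⟩ʳ_) (sym (π-point _ _)) ⟩
    g ⟨$⟩ʳ π e (cell s)            ≡⟨ cong (λ b → g ⟨$⟩ʳ π e b) (sym (coarse≡cell z)) ⟩
    g ⟨$⟩ʳ π e (coarse z)          ∎
    where
    open ≡-Reasoning
    s : State
    s = to z

  to-h : ∀ z → to (h ⟨$⟩ʳ z) ≡ step (to z)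
  to-h z = strictlyInverseˡ (step (to z))

  hⁿ-covers-f : ∀ z → coarse (pow {refinement} h (suc k) z) ≡ f ⟨$⟩ʳ coarse z
  hⁿ-covers-f z = begin
    coarse (pow {refinement} h (suc k) z)   ≡⟨ cong coarse (pow≡iterate h (suc k) z) ⟩
    coarse (iterate (h ⟨$⟩ʳ_) z (suc k))     ≡⟨ coarse≡cell _ ⟩
    cell (to (iterate (h ⟨$⟩ʳ_) z (suc k)))  ≡⟨ cong cell (iterate-natural to to-h z (suc k)) ⟩
    cell (iterate step (to z) (suc k))       ≡⟨ register-covers-f (to z) ⟩
    f ⟨$⟩ʳ cell (to z)                        ≡⟨ cong (f ⟨$⟩ʳ_) (sym (coarse≡cell z)) ⟩
    f ⟨$⟩ʳ coarse z                           ∎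
    where open ≡-Reasoning

  refinement-kind : ∀ κ → HasKind κ A → HasKind κ B → HasKind κ refinement
  refinement-kind equi   _ _ = refinement-equi
  refinement-kind dyadic (_ , r , |A|≡2^r) (_ , s , |B|≡2^s)
    with power-of-two-factor r s m
           (trans (cong (ℕ._* m) (sym |A|≡2^r)) (trans (proj₂ (proj₂ fibres)) |B|≡2^s))
  ... | t , m≡2^t = refinement-equi , s ℕ.+ t ℕ.* k , (begin
    atoms B ℕ.* m ^ k         ≡⟨ cong₂ (λ x y → x ℕ.* y ^ k) |B|≡2^s m≡2^t ⟩
    2 ^ s ℕ.* (2 ^ t) ^ k     ≡⟨ cong (2 ^ s ℕ.*_) (ℕP.^-*-assoc 2 t k) ⟩
    2 ^ s ℕ.* 2 ^ (t ℕ.* k)   ≡⟨ sym (ℕP.^-distribˡ-+-* 2 s (t ℕ.* k)) ⟩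
    2 ^ (s ℕ.+ t ℕ.* k)       ∎)
    where open ≡-Reasoning

proposition2p2 : (κ : Kind) (A B : FMBA) → HasKind κ A → HasKind κ B →
    (e : Embedding A B) (n : ℕ) → n ≥ 1 → (g : Aut A) (f : Aut B) →
    (∀ x → π e (f ⟨$⟩ʳ x) ≡ pow {A} g n (π e x)) →
    Σ FMBA λ C → HasKind κ C × Σ (Embedding B C) λ d → Σ (Aut C) λ h →
      (∀ z → π e (π d (h ⟨$⟩ʳ z)) ≡ g ⟨$⟩ʳ π e (π d z)) ×
      (∀ z → π d (pow {C} h n z) ≡ f ⟨$⟩ʳ π d z)
proposition2p2 κ A B kindA kindB e (suc k) (s≤s z≤n) g f f-covers =
  refinement , refinement-kind κ kindA kindB , embedding , h , h-covers-g , hⁿ-covers-f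
  where
  open Extension A B (equidistributed κ A kindA) (equidistributed κ B kindB) e k g f f-covers
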